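{- Let $k \ge 4$ be an integer and $n$ an integer. There exists a primitive uniquely $K_{n-1}^{(k)}$-saturated $k$-uniform hypergraph on $n$ vertices if and only if $k+2 \le n \le \frac{(k+2)^2}{4}$.
   Context: $K_r^{(k)}$ denotes the complete $k$-uniform hypergraph on $r$ vertices. A $k$-uniform hypergraph $H$ is uniquely $K_r^{(k)}$-saturated if $H$ contains no copy of $K_r^{(k)}$ (i.e., no $r$-set of vertices all of whose $k$-subsets are edges), and for every $k$-subset $S$ of $V(H)$ that is not an edge of $H$, the hypergraph $H+S$ contains exactly one copy of $K_r^{(k)}$. A vertex $v$ is dominating in $H$ if every $k$-subset of $V(H)$ containing $v$ is an edge of $H$. $H$ is primitive uniquely $K_r^{(k)}$-saturated if it is uniquely $K_r^{(k)}$-saturated and has no dominating vertex. (Here $r = n-1$ and the standing convention $k < r < n$ is in force.) -}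

module Defs where

open import Data.Nat using (ℕ)
open import Data.Bool using (Bool; true; false)
open import Data.Fin using (Fin)
open import Data.Fin.Subset using (Subset; _⊆_; _∈_; ∣_∣)
open import Data.Product using (Σ; ∃; _×_; _,_)
open import Data.Sum using (_⊎_)
open import Data.Empty using (⊥)
open import Relation.Nullary using (¬_)
open import Relation.Binary.PropositionalEquality using (_≡_)

-- A k-uniform hypergraph on vertex set Fin n, given by the indicator of
-- its edge set. Only the values on k-subsets are ever consulted; a
-- subset T is an edge of H iff ∣ T ∣ ≡ k and H T ≡ true.
Hypergraph : ℕ → Set
Hypergraph n = Subset n → Bool

Edge : ∀ {n} → Hypergraph n → Subset n → Set
Edge H T = H T ≡ true

EdgePlus : ∀ {n} → Hypergraph n → Subset n → Subset n → Set
EdgePlus H S T = (H T ≡ true) ⊎ (T ≡ S)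

IsClique : ∀ {n} → ℕ → ℕ → (Subset n → Set) → Subset n → Set
IsClique {n} k r E R =
  (∣ R ∣ ≡ r) × ((T : Subset n) → T ⊆ R → ∣ T ∣ ≡ k → E T)

UniquelySaturated : ∀ {n} → ℕ → ℕ → Hypergraph n → Set
UniquelySaturated {n} k r H =
  (¬ Σ (Subset n) (λ R → IsClique k r (Edge H) R)) ×
  ((S : Subset n) → ∣ S ∣ ≡ k → H S ≡ false →
     Σ (Subset n) (λ R → IsClique k r (EdgePlus H S) R ×
       ((R′ : Subset n) → IsClique k r (EdgePlus H S) R′ → R′ ≡ R)))

Dominating : ∀ {n} → ℕ → Hypergraph n → Fin n → Set
Dominating {n} k H v = (T : Subset n) → ∣ T ∣ ≡ k → v ∈ T → H T ≡ true

PrimitiveUniquelySaturated : ∀ {n} → ℕ → ℕ → Hypergraph n → Set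
PrimitiveUniquelySaturated {n} k r H =
  UniquelySaturated k r H × ((v : Fin n) → ¬ Dominating k H v)

module Submission where

-- On N + 1 vertices a copy of K_N^(k) is a co-singleton ∁ ⁅ a ⁆.  Necessity:
-- the clique created by a missing k-set S is ∁ ⁅ a ⁆ for an apex a that
-- avoids S and lies in every other missing k-set, so distinct missing sets
-- have distinct apexes.  Counting the incidences v ∈ S over the m missing
-- sets, where every vertex lies in one of them (primitivity) and an apex in
-- m - 1, gives  n + (m - 2) m ≤ m k,  which forces  4n ≤ (k + 2)²  (AM-GM).
-- Sufficiency: the complement of an "apex family" of k-sets is primitive
-- uniquely saturated.  Apex families arise from intervals [start j, start j + s)
-- in a window next to a core of vertices, and three choices of parameters
-- cover n = k + 2, k + 2 < n ≤ 2k, and n > 2k.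
-- The file first sets up counting (indicators, sums over vertices and over
-- subsets) and co-singletons, then proves necessity and sufficiency in turn.

open import Defs
open import Data.Nat.Properties
open import Algebra.Properties.CommutativeSemigroup +-commutativeSemigroup
  using () renaming (interchange to +-interchange)
open import Algebra.Properties.Semiring.Sum +-*-semiring
  using (sum; sum-syntax; ∑-distrib-+; *-distribˡ-sum; sum-replicate-zero)
open import Data.Bool using (false; not; if_then_else_) renaming (_≟_ to _≟ᵇ_)
open import Data.Bool.Properties using (¬-not)
open import Data.Fin using (Fin; zero; suc; toℕ; _↑ˡ_; _↑ʳ_; fromℕ<; fromℕ) renaming (_≟_ to _≟ᶠ_)
open import Data.Fin.Properties using (any?; toℕ<n; toℕ-fromℕ<; toℕ-fromℕ)
open import Data.Fin.Subset using (Subset; inside; outside; _∈_; _∉_; _⊆_; ∣_∣; ⁅_⁆; ∁; ⊥)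
open import Data.Fin.Subset.Properties
  using (_∈?_; anySubset?; x∈⁅x⁆; x≢y⇒x∉⁅y⁆; x∈∁p⇒x∉p; x∉p⇒x∈∁p; ∉⊥;
         ∣p∣≡n⇒p≡⊤; ∣∁p∣≡n∸∣p∣; ∣⁅x⁆∣≡1; ∣⊥∣≡0)
open import Data.Nat using (ℕ; zero; suc; _+_; _*_; _∸_; _⊓_; _≤_; _<_; z≤n; s≤s; _≟_; _<?_; _≤?_)
open import Data.Nat.DivMod using (_/_; _%_; m≡m%n+[m/n]*n; m%n<n; m/n*n≤m)
open import Data.Nat.Tactic.RingSolver using (solve-∀)
open import Data.Product using (Σ; ∃; ∃-syntax; _×_; _,_; proj₁; proj₂; map₂)
open import Data.Sum using (inj₁; inj₂)
open import Data.Vec using ([]; _∷_; _++_; lookup; here; there)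
open import Data.Vec.Properties
  using (≡-dec; map-replicate; lookup-++ˡ; lookup-++ʳ; []=⇒lookup; lookup⇒[]=)
open import Function.Bundles using (_⇔_; mk⇔; Equivalence)
open import Relation.Nullary using (¬_; Dec; yes; no; contradiction; _×-dec_)
open import Relation.Nullary.Decidable using (does; dec-true; dec-false; decidable-stable)
open import Relation.Binary.PropositionalEquality
  using (_≡_; _≢_; refl; sym; trans; cong; cong₂; subst; subst₂; module ≡-Reasoning)

PrimitiveExists : ℕ → ℕ → Set
PrimitiveExists n k = Σ (Hypergraph n) (PrimitiveUniquelySaturated k (n ∸ 1))

infix 4 _≟ˢ_
_≟ˢ_ : ∀ {n} → (S T : Subset n) → Dec (S ≡ T)
_≟ˢ_ = ≡-dec _≟ᵇ_

-- 𝟙 P? is 1 if P holds and 0 otherwise.  It only inspects 'does P?', so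
-- decisions obtained from one another by 'map′' have the same indicator.
𝟙 : ∀ {p} {P : Set p} → Dec P → ℕ
𝟙 P? = if does P? then 1 else 0

𝟙-yes : ∀ {p} {P : Set p} (P? : Dec P) → P → 𝟙 P? ≡ 1
𝟙-yes P? P rewrite dec-true P? P = refl

𝟙-no : ∀ {p} {P : Set p} (P? : Dec P) → ¬ P → 𝟙 P? ≡ 0
𝟙-no P? ¬P rewrite dec-false P? ¬P = refl

𝟙-* : ∀ {p q} {P : Set p} {Q : Set q} (P? : Dec P) (Q? : Dec Q) → 𝟙 P? * 𝟙 Q? ≡ 𝟙 (P? ×-dec Q?)
𝟙-* (yes _) (yes _) = refl
𝟙-* (yes _) (no _)  = refl
𝟙-* (no _)  (yes _) = refl
𝟙-* (no _)  (no _)  = refl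

𝟙-mono : ∀ {p q} {P : Set p} {Q : Set q} → (P → Q) → (P? : Dec P) (Q? : Dec Q) → 𝟙 P? ≤ 𝟙 Q?
𝟙-mono P⇒Q (yes P) Q? = ≤-reflexive (sym (𝟙-yes Q? (P⇒Q P)))
𝟙-mono P⇒Q (no _)  Q? = z≤n

𝟙-*-cong : ∀ {p} {P : Set p} {a b : ℕ} → (P → a ≡ b) → (P? : Dec P) → 𝟙 P? * a ≡ 𝟙 P? * b
𝟙-*-cong P⇒a≡b (yes P) = cong (1 *_) (P⇒a≡b P)
𝟙-*-cong P⇒a≡b (no _)  = refl

𝟙-split : ∀ {p q r} {P : Set p} {Q : Set q} {R : Set r} → (P → ¬ R → Q) →
          (P? : Dec P) (Q? : Dec Q) (R? : Dec R) → 𝟙 P? ≤ 𝟙 R? + 𝟙 P? * 𝟙 Q?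
𝟙-split P⇒Q (no _)  Q? R?      = z≤n
𝟙-split P⇒Q (yes P) Q? (yes _) = s≤s z≤n
𝟙-split P⇒Q (yes P) Q? (no ¬R) = ≤-reflexive (sym (cong (1 *_) (𝟙-yes Q? (P⇒Q P ¬R))))

sum-mono : ∀ {n} {f g : Fin n → ℕ} → (∀ i → f i ≤ g i) → sum f ≤ sum g
sum-mono {zero}  f≤g = z≤n
sum-mono {suc n} f≤g = +-mono-≤ (f≤g zero) (sum-mono (λ i → f≤g (suc i)))

sum-ones : ∀ n → ∑[ i < n ] 1 ≡ n
sum-ones zero    = refl
sum-ones (suc n) = cong suc (sum-ones n)

sum-𝟙-≡ : ∀ {n} (a : Fin n) → ∑[ i < n ] 𝟙 (a ≟ᶠ i) ≡ 1
sum-𝟙-≡ {suc n} zero    = cong suc (sum-replicate-zero n)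
sum-𝟙-≡ {suc n} (suc a) = sum-𝟙-≡ a

∣p∣≡sum : ∀ {n} (p : Subset n) → ∣ p ∣ ≡ ∑[ v < n ] 𝟙 (v ∈? p)
∣p∣≡sum []            = refl
∣p∣≡sum (inside ∷ p)  = cong suc (∣p∣≡sum p)
∣p∣≡sum (outside ∷ p) = ∣p∣≡sum p

∑ₛ : ∀ {n} → (Subset n → ℕ) → ℕ
∑ₛ {zero}  f = f []
∑ₛ {suc n} f = ∑ₛ (λ T → f (inside ∷ T)) + ∑ₛ (λ T → f (outside ∷ T))

∑ₛ-cong : ∀ {n} {f g : Subset n → ℕ} → (∀ T → f T ≡ g T) → ∑ₛ f ≡ ∑ₛ g
∑ₛ-cong {zero}  f≡g = f≡g []
∑ₛ-cong {suc n} f≡g = cong₂ _+_ (∑ₛ-cong λ T → f≡g (inside ∷ T)) (∑ₛ-cong λ T → f≡g (outside ∷ T))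

∑ₛ-mono : ∀ {n} {f g : Subset n → ℕ} → (∀ T → f T ≤ g T) → ∑ₛ f ≤ ∑ₛ g
∑ₛ-mono {zero}  f≤g = f≤g []
∑ₛ-mono {suc n} f≤g = +-mono-≤ (∑ₛ-mono λ T → f≤g (inside ∷ T)) (∑ₛ-mono λ T → f≤g (outside ∷ T))

term≤∑ₛ : ∀ {n} (f : Subset n → ℕ) T → f T ≤ ∑ₛ f
term≤∑ₛ {zero}  f []            = ≤-refl
term≤∑ₛ {suc n} f (inside ∷ T)  = ≤-trans (term≤∑ₛ (λ T → f (inside ∷ T)) T) (m≤m+n _ _)
term≤∑ₛ {suc n} f (outside ∷ T) = ≤-trans (term≤∑ₛ (λ T → f (outside ∷ T)) T) (m≤n+m _ _)

∑ₛ-vanish : ∀ {n} {f : Subset n → ℕ} → (∀ T → f T ≡ 0) → ∑ₛ f ≡ 0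
∑ₛ-vanish {zero}  f≡0 = f≡0 []
∑ₛ-vanish {suc n} f≡0 = cong₂ _+_ (∑ₛ-vanish λ T → f≡0 (inside ∷ T)) (∑ₛ-vanish λ T → f≡0 (outside ∷ T))

∑ₛ-distrib-+ : ∀ {n} (f g : Subset n → ℕ) → ∑ₛ (λ T → f T + g T) ≡ ∑ₛ f + ∑ₛ g
∑ₛ-distrib-+ {zero}  f g = refl
∑ₛ-distrib-+ {suc n} f g = begin
  ∑ₛ (λ T → fᵢ T + gᵢ T) + ∑ₛ (λ T → fₒ T + gₒ T)
    ≡⟨ cong₂ _+_ (∑ₛ-distrib-+ fᵢ gᵢ) (∑ₛ-distrib-+ fₒ gₒ) ⟩
  (∑ₛ fᵢ + ∑ₛ gᵢ) + (∑ₛ fₒ + ∑ₛ gₒ)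
    ≡⟨ +-interchange (∑ₛ fᵢ) (∑ₛ gᵢ) (∑ₛ fₒ) (∑ₛ gₒ) ⟩
  (∑ₛ fᵢ + ∑ₛ fₒ) + (∑ₛ gᵢ + ∑ₛ gₒ) ∎
  where
  open ≡-Reasoning
  fᵢ fₒ gᵢ gₒ : Subset n → ℕ
  fᵢ T = f (inside ∷ T)
  fₒ T = f (outside ∷ T)
  gᵢ T = g (inside ∷ T)
  gₒ T = g (outside ∷ T)

∑ₛ-*ʳ : ∀ {n} (f : Subset n → ℕ) c → ∑ₛ (λ T → f T * c) ≡ ∑ₛ f * c
∑ₛ-*ʳ {zero}  f c = refl
∑ₛ-*ʳ {suc n} f c = trans (cong₂ _+_ (∑ₛ-*ʳ (λ T → f (inside ∷ T)) c) (∑ₛ-*ʳ (λ T → f (outside ∷ T)) c))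
                          (sym (*-distribʳ-+ c (∑ₛ λ T → f (inside ∷ T)) (∑ₛ λ T → f (outside ∷ T))))

∑ₛ-∑-comm : ∀ {n N} (f : Subset n → Fin N → ℕ) → ∑ₛ (λ T → ∑[ v < N ] f T v) ≡ ∑[ v < N ] ∑ₛ (λ T → f T v)
∑ₛ-∑-comm {zero}  f = refl
∑ₛ-∑-comm {suc n} f = trans (cong₂ _+_ (∑ₛ-∑-comm λ T → f (inside ∷ T)) (∑ₛ-∑-comm λ T → f (outside ∷ T)))
                            (sym (∑-distrib-+ (λ v → ∑ₛ λ T → f (inside ∷ T) v) (λ v → ∑ₛ λ T → f (outside ∷ T) v)))

∑ₛ-𝟙-≡ : ∀ {n} (S : Subset n) → ∑ₛ (λ T → 𝟙 (T ≟ˢ S)) ≡ 1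
∑ₛ-𝟙-≡ {zero}  []            = refl
∑ₛ-𝟙-≡ {suc n} (inside ∷ S)  = cong₂ _+_ (∑ₛ-𝟙-≡ S) (∑ₛ-vanish {f = λ T → 𝟙 (outside ∷ T ≟ˢ inside ∷ S)} λ _ → refl)
∑ₛ-𝟙-≡ {suc n} (outside ∷ S) = cong₂ _+_ (∑ₛ-vanish {f = λ T → 𝟙 (inside ∷ T ≟ˢ outside ∷ S)} λ _ → refl) (∑ₛ-𝟙-≡ S)

∈∁⁅⁆ : ∀ {n} {v a : Fin n} → v ≢ a → v ∈ ∁ ⁅ a ⁆
∈∁⁅⁆ v≢a = x∉p⇒x∈∁p (x≢y⇒x∉⁅y⁆ v≢a)

∉∁⁅⁆ : ∀ {n} (a : Fin n) → a ∉ ∁ ⁅ a ⁆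
∉∁⁅⁆ a a∈∁⁅a⁆ = x∈∁p⇒x∉p a∈∁⁅a⁆ (x∈⁅x⁆ a)

⊆∁⁅⁆⇒∉ : ∀ {n} {a : Fin n} {T : Subset n} → T ⊆ ∁ ⁅ a ⁆ → a ∉ T
⊆∁⁅⁆⇒∉ {a = a} T⊆∁⁅a⁆ a∈T = ∉∁⁅⁆ a (T⊆∁⁅a⁆ a∈T)

∉⇒⊆∁⁅⁆ : ∀ {n} {a : Fin n} {T : Subset n} → a ∉ T → T ⊆ ∁ ⁅ a ⁆
∉⇒⊆∁⁅⁆ a∉T v∈T = ∈∁⁅⁆ λ { refl → a∉T v∈T }

∣∁⁅⁆∣ : ∀ {n} (a : Fin n) → ∣ ∁ ⁅ a ⁆ ∣ ≡ n ∸ 1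
∣∁⁅⁆∣ {n} a = trans (∣∁p∣≡n∸∣p∣ ⁅ a ⁆) (cong (n ∸_) (∣⁅x⁆∣≡1 a))

-- Conversely, every subset of Fin (suc n) of size n is a co-singleton, so
-- a copy of K_n^(k) on n + 1 vertices is determined by the vertex it misses.
coSingleton : ∀ {n} (R : Subset (suc n)) → ∣ R ∣ ≡ n → ∃[ a ] R ≡ ∁ ⁅ a ⁆
coSingleton {n} (outside ∷ R) ∣R∣≡n =
  zero , cong (outside ∷_) (trans (∣p∣≡n⇒p≡⊤ ∣R∣≡n) (sym (map-replicate not outside n)))
coSingleton {zero}  (inside ∷ []) ()
coSingleton {suc n} (inside ∷ R)  ∣R∣≡n with coSingleton R (suc-injective ∣R∣≡n)
... | a , refl = suc a , refl

-- The bound for an apex vertex: its degree d satisfies m ≤ 1 + d and d ≥ 1,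
-- and it is the apex of at most one missing edge.
apexVertex-arith : ∀ {m c d} → c ≤ 1 → m ≤ 1 + d → 1 ≤ d → 1 + (m ∸ 2) * c ≤ d
apexVertex-arith {m} {c} {d} c≤1 m≤1+d 1≤d = begin
  1 + (m ∸ 2) * c  ≤⟨ +-monoʳ-≤ 1 (*-monoʳ-≤ (m ∸ 2) c≤1) ⟩
  1 + (m ∸ 2) * 1  ≡⟨ cong (1 +_) (*-identityʳ (m ∸ 2)) ⟩
  1 + (m ∸ 2)      ≤⟨ +-monoʳ-≤ 1 (∸-monoˡ-≤ 2 m≤1+d) ⟩
  1 + (d ∸ 1)      ≡⟨ m+[n∸m]≡n 1≤d ⟩
  d                ∎
  where open ≤-Reasoning

am-gm-ordered : ∀ {x y} → x ≤ y → 2 * x * y ≤ x * x + y * y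
am-gm-ordered {x} x≤y with m≤n⇒∃[o]m+o≡n x≤y
... | d , refl = ≤-trans (m≤m+n (2 * x * (x + d)) (d * d)) (≤-reflexive (sym (square-gap x d)))
  where
  square-gap : ∀ x d → x * x + (x + d) * (x + d) ≡ 2 * x * (x + d) + d * d
  square-gap = solve-∀

am-gm : ∀ x y → 2 * x * y ≤ x * x + y * y
am-gm x y with ≤-total x y
... | inj₁ x≤y = am-gm-ordered x≤y
... | inj₂ y≤x = subst₂ _≤_ (product-comm y x) (+-comm (y * y) (x * x)) (am-gm-ordered y≤x)
  where
  product-comm : ∀ y x → 2 * y * x ≡ 2 * x * y
  product-comm = solve-∀

-- The counting inequality  N + (m - 2) m ≤ m k  forces  4N ≤ (k + 2)²,
-- since  4N + 4m² ≤ 4mk + 8m = 2 (k + 2) (2m) ≤ (k + 2)² + 4m².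
square-bound : ∀ N k m → k + 2 ≤ N → N + (m ∸ 2) * m ≤ m * k → 4 * N ≤ (k + 2) * (k + 2)
square-bound N k zero k+2≤N counting =
  contradiction (m+n≤o⇒n≤o k (≤-trans k+2≤N (m+n≤o⇒m≤o N counting))) λ ()
square-bound N k (suc zero) k+2≤N counting =
  contradiction (+-cancelˡ-≤ k 2 0 (≤-trans k+2≤N (m+n≤o⇒m≤o N counting))) λ ()
square-bound N k m@(suc (suc p)) k+2≤N counting = +-cancelʳ-≤ (4 * m * m) (4 * N) ((k + 2) * (k + 2)) (begin
  4 * N + 4 * m * m                     ≡⟨ expand-left N p ⟩
  4 * (N + p * m) + 8 * m               ≤⟨ +-monoˡ-≤ (8 * m) (*-monoʳ-≤ 4 counting) ⟩
  4 * (m * k) + 8 * m                   ≡⟨ regroup k m ⟩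
  2 * (k + 2) * (2 * m)                 ≤⟨ am-gm (k + 2) (2 * m) ⟩
  (k + 2) * (k + 2) + 2 * m * (2 * m)   ≡⟨ cong ((k + 2) * (k + 2) +_) (double-square m) ⟩
  (k + 2) * (k + 2) + 4 * m * m         ∎)
  where
  open ≤-Reasoning
  expand-left : ∀ N p → 4 * N + 4 * (2 + p) * (2 + p) ≡ 4 * (N + p * (2 + p)) + 8 * (2 + p)
  expand-left = solve-∀
  regroup : ∀ k m → 4 * (m * k) + 8 * m ≡ 2 * (k + 2) * (2 * m)
  regroup = solve-∀
  double-square : ∀ m → 2 * m * (2 * m) ≡ 4 * m * m
  double-square = solve-∀

-- Necessity.  The module works for any K_n^(k)-saturated hypergraph on
-- n + 1 vertices without dominating vertex.

module Necessity
  {n k : ℕ} (H : Hypergraph (suc n))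
  (clique-free : ¬ Σ (Subset (suc n)) (IsClique k n (Edge H)))
  (completes   : ∀ S → ∣ S ∣ ≡ k → H S ≡ false → Σ (Subset (suc n)) (IsClique k n (EdgePlus H S)))
  (undominated : ∀ v → ¬ Dominating k H v)
  where

  Missing : Subset (suc n) → Set
  Missing T = ∣ T ∣ ≡ k × H T ≡ false

  missing? : ∀ T → Dec (Missing T)
  missing? T = ∣ T ∣ ≟ k ×-dec H T ≟ᵇ false

  IsApex : Subset (suc n) → Fin (suc n) → Set
  IsApex S a = a ∉ S × (∀ T → Missing T → T ≢ S → a ∈ T)

  -- The clique created by a missing edge S is ∁ ⁅ a ⁆ for an apex a of S.
  apexOf : ∀ {S} → Missing S → ∃ (IsApex S)
  apexOf {S} (∣S∣≡k , S∉H) with completes S ∣S∣≡k S∉H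
  ... | R , ∣R∣≡n , R-complete with coSingleton R ∣R∣≡n
  ... | a , refl = a , a∉S , a∈others
    where
    -- if a ∈ S then S is not inside R, so R is already a clique of H
    a∉S : a ∉ S
    a∉S a∈S = clique-free (R , ∣R∣≡n , λ T T⊆R ∣T∣≡k → edge T T⊆R (R-complete T T⊆R ∣T∣≡k))
      where
      edge : ∀ T → T ⊆ R → EdgePlus H S T → Edge H T
      edge T T⊆R (inj₁ T∈H) = T∈H
      edge T T⊆R (inj₂ refl) = contradiction a∈S (⊆∁⁅⁆⇒∉ T⊆R)
    -- a missing T avoiding a lies inside R, so it must be S itself
    a∈others : ∀ T → Missing T → T ≢ S → a ∈ T
    a∈others T (∣T∣≡k , T∉H) T≢S = decidable-stable (a ∈? T) λ a∉T →
      inside-R (R-complete T (∉⇒⊆∁⁅⁆ a∉T) ∣T∣≡k)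
      where
      inside-R : ¬ EdgePlus H S T
      inside-R (inj₁ T∈H) = contradiction (trans (sym T∈H) T∉H) λ ()
      inside-R (inj₂ T≡S) = T≢S T≡S

  -- A chosen apex for every missing edge (an arbitrary vertex otherwise).
  apex : Subset (suc n) → Fin (suc n)
  apex T with missing? T
  ... | yes T-missing = proj₁ (apexOf T-missing)
  ... | no _          = zero

  apex-isApex : ∀ {S} → Missing S → IsApex S (apex S)
  apex-isApex {S} S-missing with missing? S
  ... | yes S-missing′ = proj₂ (apexOf S-missing′)
  ... | no ¬S-missing  = contradiction S-missing ¬S-missing

  apex-injective : ∀ {S T} → Missing S → Missing T → apex S ≡ apex T → S ≡ T
  apex-injective {S} {T} S-missing T-missing apexS≡apexT =
    decidable-stable (S ≟ˢ T) λ S≢T →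
      proj₁ (apex-isApex S-missing)
        (subst (_∈ S) (sym apexS≡apexT) (proj₂ (apex-isApex T-missing) S S-missing S≢T))

  missingCount : ℕ
  missingCount = ∑ₛ λ T → 𝟙 (missing? T)

  degree : Fin (suc n) → ℕ
  degree v = ∑ₛ λ T → 𝟙 (missing? T) * 𝟙 (v ∈? T)

  apexCount : Fin (suc n) → ℕ
  apexCount v = ∑ₛ λ T → 𝟙 (missing? T) * 𝟙 (apex T ≟ᶠ v)

  degree-sum : ∑[ v < suc n ] degree v ≡ missingCount * k
  degree-sum = begin
    ∑[ v < suc n ] ∑ₛ (λ T → 𝟙 (missing? T) * 𝟙 (v ∈? T)) ≡⟨ sym (∑ₛ-∑-comm (λ T v → 𝟙 (missing? T) * 𝟙 (v ∈? T))) ⟩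
    ∑ₛ (λ T → ∑[ v < suc n ] (𝟙 (missing? T) * 𝟙 (v ∈? T))) ≡⟨ ∑ₛ-cong (λ T → sym (*-distribˡ-sum (𝟙 (missing? T)) (λ v → 𝟙 (v ∈? T)))) ⟩
    ∑ₛ (λ T → 𝟙 (missing? T) * ∑[ v < suc n ] 𝟙 (v ∈? T)) ≡⟨ ∑ₛ-cong (λ T → cong (𝟙 (missing? T) *_) (sym (∣p∣≡sum T))) ⟩
    ∑ₛ (λ T → 𝟙 (missing? T) * ∣ T ∣)                      ≡⟨ ∑ₛ-cong (λ T → 𝟙-*-cong proj₁ (missing? T)) ⟩
    ∑ₛ (λ T → 𝟙 (missing? T) * k)                          ≡⟨ ∑ₛ-*ʳ (λ T → 𝟙 (missing? T)) k ⟩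
    missingCount * k                                       ∎
    where open ≡-Reasoning

  -- Every missing edge has exactly one apex, so the apex counts sum to m.
  apexCount-sum : ∑[ v < suc n ] apexCount v ≡ missingCount
  apexCount-sum = begin
    ∑[ v < suc n ] ∑ₛ (λ T → 𝟙 (missing? T) * 𝟙 (apex T ≟ᶠ v)) ≡⟨ sym (∑ₛ-∑-comm (λ T v → 𝟙 (missing? T) * 𝟙 (apex T ≟ᶠ v))) ⟩
    ∑ₛ (λ T → ∑[ v < suc n ] (𝟙 (missing? T) * 𝟙 (apex T ≟ᶠ v))) ≡⟨ ∑ₛ-cong (λ T → sym (*-distribˡ-sum (𝟙 (missing? T)) (λ v → 𝟙 (apex T ≟ᶠ v)))) ⟩
    ∑ₛ (λ T → 𝟙 (missing? T) * ∑[ v < suc n ] 𝟙 (apex T ≟ᶠ v)) ≡⟨ ∑ₛ-cong (λ T → cong (𝟙 (missing? T) *_) (sum-𝟙-≡ (apex T))) ⟩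
    ∑ₛ (λ T → 𝟙 (missing? T) * 1)                              ≡⟨ ∑ₛ-*ʳ (λ T → 𝟙 (missing? T)) 1 ⟩
    missingCount * 1                                           ≡⟨ *-identityʳ missingCount ⟩
    missingCount                                               ∎
    where open ≡-Reasoning

  -- Primitivity: every vertex lies in some missing edge.
  degree-positive : ∀ v → 1 ≤ degree v
  degree-positive v with anySubset? (λ T → missing? T ×-dec v ∈? T)
  ... | yes (T , T-missing , v∈T) = begin
    1                                 ≡⟨ sym (𝟙-yes (missing? T ×-dec v ∈? T) (T-missing , v∈T)) ⟩
    𝟙 (missing? T ×-dec v ∈? T)       ≡⟨ sym (𝟙-* (missing? T) (v ∈? T)) ⟩
    𝟙 (missing? T) * 𝟙 (v ∈? T)       ≤⟨ term≤∑ₛ (λ T → 𝟙 (missing? T) * 𝟙 (v ∈? T)) T ⟩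
    degree v                          ∎
    where open ≤-Reasoning
  ... | no none = contradiction dominating (undominated v)
    where
    dominating : Dominating k H v
    dominating T ∣T∣≡k v∈T = ¬-not λ T∉H → none (T , (∣T∣≡k , T∉H) , v∈T)

  -- The apex of S lies in every missing edge but S.
  apex-degree : ∀ {S} → Missing S → missingCount ≤ 1 + degree (apex S)
  apex-degree {S} S-missing = begin
    ∑ₛ (λ T → 𝟙 (missing? T))                                       ≤⟨ ∑ₛ-mono bound ⟩
    ∑ₛ (λ T → 𝟙 (T ≟ˢ S) + 𝟙 (missing? T) * 𝟙 (apex S ∈? T))         ≡⟨ ∑ₛ-distrib-+ (λ T → 𝟙 (T ≟ˢ S)) (λ T → 𝟙 (missing? T) * 𝟙 (apex S ∈? T)) ⟩
    ∑ₛ (λ T → 𝟙 (T ≟ˢ S)) + degree (apex S)                          ≡⟨ cong (_+ degree (apex S)) (∑ₛ-𝟙-≡ S) ⟩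
    1 + degree (apex S)                                              ∎
    where
    open ≤-Reasoning
    bound : ∀ T → 𝟙 (missing? T) ≤ 𝟙 (T ≟ˢ S) + 𝟙 (missing? T) * 𝟙 (apex S ∈? T)
    bound T = 𝟙-split (proj₂ (apex-isApex S-missing) T) (missing? T) (apex S ∈? T) (T ≟ˢ S)

  apexCount≤1 : ∀ {S} → Missing S → apexCount (apex S) ≤ 1
  apexCount≤1 {S} S-missing = begin
    ∑ₛ (λ T → 𝟙 (missing? T) * 𝟙 (apex T ≟ᶠ apex S)) ≡⟨ ∑ₛ-cong (λ T → 𝟙-* (missing? T) (apex T ≟ᶠ apex S)) ⟩
    ∑ₛ (λ T → 𝟙 (missing? T ×-dec apex T ≟ᶠ apex S)) ≤⟨ ∑ₛ-mono (λ T → 𝟙-mono (λ (T-missing , same) → apex-injective T-missing S-missing same)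
                                                                              (missing? T ×-dec apex T ≟ᶠ apex S) (T ≟ˢ S)) ⟩
    ∑ₛ (λ T → 𝟙 (T ≟ˢ S))                            ≡⟨ ∑ₛ-𝟙-≡ S ⟩
    1                                               ∎
    where open ≤-Reasoning

  apexCount-vanish : ∀ {v} → ¬ ∃ (λ T → Missing T × apex T ≡ v) → apexCount v ≡ 0
  apexCount-vanish {v} none = ∑ₛ-vanish λ T →
    trans (𝟙-* (missing? T) (apex T ≟ᶠ v)) (𝟙-no (missing? T ×-dec apex T ≟ᶠ v) λ Tv → none (T , Tv))

  vertex-bound : ∀ v → 1 + (missingCount ∸ 2) * apexCount v ≤ degree v
  vertex-bound v with anySubset? (λ T → missing? T ×-dec apex T ≟ᶠ v)
  ... | yes (S , S-missing , refl) =
    apexVertex-arith (apexCount≤1 S-missing) (apex-degree S-missing) (degree-positive (apex S))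
  ... | no none rewrite apexCount-vanish none | *-zeroʳ (missingCount ∸ 2) = degree-positive v

  counting-inequality : suc n + (missingCount ∸ 2) * missingCount ≤ missingCount * k
  counting-inequality = begin
    suc n + (m ∸ 2) * m                                 ≡⟨ cong₂ _+_ (sym (sum-ones (suc n))) (cong ((m ∸ 2) *_) (sym apexCount-sum)) ⟩
    ∑[ v < suc n ] 1 + (m ∸ 2) * ∑[ v < suc n ] apexCount v ≡⟨ cong (∑[ v < suc n ] 1 +_) (*-distribˡ-sum (m ∸ 2) apexCount) ⟩
    ∑[ v < suc n ] 1 + ∑[ v < suc n ] ((m ∸ 2) * apexCount v) ≡⟨ sym (∑-distrib-+ (λ _ → 1) (λ v → (m ∸ 2) * apexCount v)) ⟩
    ∑[ v < suc n ] (1 + (m ∸ 2) * apexCount v)           ≤⟨ sum-mono vertex-bound ⟩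
    ∑[ v < suc n ] degree v                             ≡⟨ degree-sum ⟩
    m * k                                               ∎
    where
    open ≤-Reasoning
    m : ℕ
    m = missingCount

necessary : ∀ {N k} → k < N ∸ 1 → PrimitiveExists N k → k + 2 ≤ N × 4 * N ≤ (k + 2) * (k + 2)
necessary {suc n} {k} k<n (H , (clique-free , saturated) , undominated) =
  k+2≤N , square-bound (suc n) k missingCount k+2≤N counting-inequality
  where
  open Necessity H clique-free (λ S ∣S∣≡k S∉H → map₂ proj₁ (saturated S ∣S∣≡k S∉H)) undominated
  k+2≤N : k + 2 ≤ suc n
  k+2≤N = subst (_≤ suc n) (+-comm 2 k) (s≤s k<n)

-- Sufficiency, step 1: apex families give primitive hypergraphs.

-- These are exactly
-- the non-edge structures found in the necessity argument.
record ApexFamily (n k m : ℕ) : Set where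
  field
    member  : Fin m → Subset (suc n)
    apex    : Fin m → Fin (suc n)
    size    : ∀ j → ∣ member j ∣ ≡ k
    apex∉   : ∀ j → apex j ∉ member j
    apex∈   : ∀ {i j} → i ≢ j → apex j ∈ member i
    covered : ∀ v → ∃[ j ] v ∈ member j
    avoided : ∀ v j → v ≢ apex j → ∃[ i ] i ≢ j × v ∉ member i

-- The hypergraph whose non-edges among the k-sets are exactly the members
-- of an apex family is primitive uniquely K_n^(k)-saturated: adding M j
-- creates the clique ∁ ⁅ a j ⁆ and no other.
module FamilyHypergraph {n k m} (F : ApexFamily n k m) where
  open ApexFamily F

  IsMember : Subset (suc n) → Set
  IsMember T = ∃[ j ] T ≡ member j

  isMember? : ∀ T → Dec (IsMember T)
  isMember? T = any? λ j → T ≟ˢ member j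

  H : Hypergraph (suc n)
  H T = not (does (isMember? T))

  nonEdge⇒member : ∀ {T} → H T ≡ false → IsMember T
  nonEdge⇒member {T} T∉H = decidable-stable (isMember? T) λ ¬member →
    contradiction (trans (sym T∉H) (cong not (dec-false (isMember? T) ¬member))) λ ()

  member∉H : ∀ j → ¬ Edge H (member j)
  member∉H j Mj∈H = contradiction (trans (sym Mj∈H) (cong not (dec-true (isMember? (member j)) (j , refl)))) λ ()

  member-injective : ∀ {i j} → member i ≡ member j → i ≡ j
  member-injective {i} {j} Mi≡Mj = decidable-stable (i ≟ᶠ j) λ i≢j →
    apex∉ j (subst (apex j ∈_) Mi≡Mj (apex∈ i≢j))

  -- Every vertex v is avoided by some member: v lies in some M j, so it is
  -- not the apex of M j and is avoided by another member.
  avoided-somewhere : ∀ v → ∃[ i ] v ∉ member i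
  avoided-somewhere v with covered v
  ... | j , v∈Mj with avoided v j (λ { refl → apex∉ j v∈Mj })
  ... | i , _ , v∉Mi = i , v∉Mi

  -- A clique ∁ ⁅ a ⁆ of H would contain a member avoiding a.
  clique-free : ¬ Σ (Subset (suc n)) (IsClique k n (Edge H))
  clique-free (R , ∣R∣≡n , R-clique) with coSingleton R ∣R∣≡n
  ... | a , refl with avoided-somewhere a
  ... | i , a∉Mi = member∉H i (R-clique (member i) (∉⇒⊆∁⁅⁆ a∉Mi) (size i))

  -- The only member inside ∁ ⁅ a j ⁆ is M j itself.
  completion : ∀ j → IsClique k n (EdgePlus H (member j)) (∁ ⁅ apex j ⁆)
  completion j = ∣∁⁅⁆∣ (apex j) , edge
    where
    edge : ∀ T → T ⊆ ∁ ⁅ apex j ⁆ → ∣ T ∣ ≡ k → EdgePlus H (member j) T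
    edge T T⊆R _ with isMember? T
    ... | no _ = inj₁ refl
    ... | yes (i , refl) with i ≟ᶠ j
    ...   | yes refl = inj₂ refl
    ...   | no i≢j   = contradiction (apex∈ i≢j) (⊆∁⁅⁆⇒∉ T⊆R)

  -- Any other clique ∁ ⁅ b ⁆ contains a member other than M j.
  completion-unique : ∀ j R′ → IsClique k n (EdgePlus H (member j)) R′ → R′ ≡ ∁ ⁅ apex j ⁆
  completion-unique j R′ (∣R′∣≡n , R′-clique) with coSingleton R′ ∣R′∣≡n
  ... | b , refl with b ≟ᶠ apex j
  ...   | yes refl = refl
  ...   | no b≢aj with avoided b j b≢aj
  ...     | i , i≢j , b∉Mi with R′-clique (member i) (∉⇒⊆∁⁅⁆ b∉Mi) (size i)
  ...       | inj₁ Mi∈H  = contradiction Mi∈H (member∉H i)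
  ...       | inj₂ Mi≡Mj = contradiction (member-injective Mi≡Mj) i≢j

  undominated : ∀ v → ¬ Dominating k H v
  undominated v dominating with covered v
  ... | j , v∈Mj = member∉H j (dominating (member j) (size j) v∈Mj)

  saturate : ∀ {S} → IsMember S →
    Σ (Subset (suc n)) λ R → IsClique k n (EdgePlus H S) R × (∀ R′ → IsClique k n (EdgePlus H S) R′ → R′ ≡ R)
  saturate (j , refl) = ∁ ⁅ apex j ⁆ , completion j , completion-unique j

  primitive-saturated : PrimitiveUniquelySaturated k n H
  primitive-saturated = (clique-free , λ S _ S∉H → saturate (nonEdge⇒member S∉H)) , undominated

-- Sufficiency, step 2: interval families give apex families.

-- Vertices of Fin (m + w) are core vertices a ↑ˡ w or window vertices m ↑ʳ x,
-- and subsets are concatenations p ++ q of a core part and a window part.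
data Side (m w : ℕ) : Fin (m + w) → Set where
  core   : (a : Fin m) → Side m w (a ↑ˡ w)
  window : (x : Fin w) → Side m w (m ↑ʳ x)

side : ∀ {m w} (v : Fin (m + w)) → Side m w v
side {zero}  v       = window v
side {suc m} zero    = core zero
side {suc m} (suc v) with side {m} v
... | core a   = core (suc a)
... | window x = window x

∣p++q∣ : ∀ {m w} (p : Subset m) (q : Subset w) → ∣ p ++ q ∣ ≡ ∣ p ∣ + ∣ q ∣
∣p++q∣ []            q = refl
∣p++q∣ (inside ∷ p)  q = cong suc (∣p++q∣ p q)
∣p++q∣ (outside ∷ p) q = ∣p++q∣ p q

∈-transport : ∀ {n n′} {p : Subset n} {q : Subset n′} {x y} → lookup p x ≡ lookup q y → x ∈ p → y ∈ q
∈-transport p[x]≡q[y] x∈p = lookup⇒[]= _ _ (trans (sym p[x]≡q[y]) ([]=⇒lookup x∈p))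

∈-++ˡ : ∀ {m w} (p : Subset m) (q : Subset w) a → (a ↑ˡ w ∈ p ++ q) ⇔ (a ∈ p)
∈-++ˡ p q a = mk⇔ (∈-transport (lookup-++ˡ p q a)) (∈-transport (sym (lookup-++ˡ p q a)))

∈-++ʳ : ∀ {m w} (p : Subset m) (q : Subset w) x → (m ↑ʳ x ∈ p ++ q) ⇔ (x ∈ q)
∈-++ʳ p q x = mk⇔ (∈-transport (lookup-++ʳ p q x)) (∈-transport (sym (lookup-++ʳ p q x)))

InInterval : ℕ → ℕ → ℕ → Set
InInterval c s x = c ≤ x × x < c + s

interval : ℕ → ℕ → (w : ℕ) → Subset w
interval _       _       zero    = []
interval zero    zero    (suc w) = ⊥
interval zero    (suc s) (suc w) = inside  ∷ interval zero s w
interval (suc c) s       (suc w) = outside ∷ interval c s w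

∣interval∣ : ∀ c s w → c + s ≤ w → ∣ interval c s w ∣ ≡ s
∣interval∣ zero    zero    zero    _         = refl
∣interval∣ zero    zero    (suc w) _         = ∣⊥∣≡0 (suc w)
∣interval∣ zero    (suc s) (suc w) (s≤s fit) = cong suc (∣interval∣ zero s w fit)
∣interval∣ (suc c) s       (suc w) (s≤s fit) = ∣interval∣ c s w fit

interval-∈ : ∀ {c s w} {x : Fin w} → InInterval c s (toℕ x) → x ∈ interval c s w
interval-∈ {zero}  {zero}  {suc w} (_ , ())
interval-∈ {zero}  {suc s} {suc w} {zero}  _                   = here
interval-∈ {zero}  {suc s} {suc w} {suc x} (_ , s≤s x<s)       = there (interval-∈ (z≤n , x<s))
interval-∈ {suc c} {s}     {suc w} {suc x} (s≤s c≤x , s≤s x<e) = there (interval-∈ (c≤x , x<e))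

∈-interval : ∀ {c s w} {x : Fin w} → x ∈ interval c s w → InInterval c s (toℕ x)
∈-interval {zero}  {zero}  {suc w}         x∈⊥       = contradiction x∈⊥ ∉⊥
∈-interval {zero}  {suc s} {suc w} {zero}  here      = z≤n , s≤s z≤n
∈-interval {zero}  {suc s} {suc w} {suc x} (there h) = z≤n , s≤s (proj₂ (∈-interval h))
∈-interval {suc c} {s}     {suc w} {suc x} (there h) = s≤s (proj₁ (∈-interval h)) , s≤s (proj₂ (∈-interval h))

another : ∀ {m} → 1 ≤ m → (a : Fin (suc m)) → ∃[ j ] j ≢ a
another {suc m} _ zero    = suc zero , λ ()
another {suc m} _ (suc a) = zero , λ ()

-- An interval family: suc m intervals [start j, start j + s) in a window
-- Fin w that cover the window, such that every window point is missed by
-- two different intervals.  On the vertex set Fin (suc m) ⊎ Fin w the sets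
--   M j = (∁ ⁅ j ⁆) ++ [start j, start j + s)
-- form an apex family of (m + s)-sets, with apex j on the core side.
module IntervalFamily
  {m w s : ℕ} (start : Fin (suc m) → ℕ) (1≤m : 1 ≤ m)
  (fits        : ∀ j → start j + s ≤ w)
  (covers      : ∀ (x : Fin w) → ∃[ j ] InInterval (start j) s (toℕ x))
  (missedTwice : ∀ (x : Fin w) → ∃[ j₁ ] ∃[ j₂ ] j₁ ≢ j₂ ×
                   ¬ InInterval (start j₁) s (toℕ x) × ¬ InInterval (start j₂) s (toℕ x))
  where

  member : Fin (suc m) → Subset (suc m + w)
  member j = ∁ ⁅ j ⁆ ++ interval (start j) s w

  core∈ : ∀ {a j} → a ≢ j → a ↑ˡ w ∈ member j
  core∈ {a} {j} a≢j = Equivalence.from (∈-++ˡ (∁ ⁅ j ⁆) _ a) (∈∁⁅⁆ a≢j)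

  core∉ : ∀ a → a ↑ˡ w ∉ member a
  core∉ a a∈Ma = ∉∁⁅⁆ a (Equivalence.to (∈-++ˡ (∁ ⁅ a ⁆) _ a) a∈Ma)

  window∈ : ∀ {x j} → InInterval (start j) s (toℕ x) → suc m ↑ʳ x ∈ member j
  window∈ {x} {j} x∈I = Equivalence.from (∈-++ʳ (∁ ⁅ j ⁆) _ x) (interval-∈ x∈I)

  window∉ : ∀ {x j} → ¬ InInterval (start j) s (toℕ x) → suc m ↑ʳ x ∉ member j
  window∉ {x} {j} x∉I x∈Mj = x∉I (∈-interval (Equivalence.to (∈-++ʳ (∁ ⁅ j ⁆) _ x) x∈Mj))

  family : ApexFamily (m + w) (m + s) (suc m)
  family = record
    { member  = member
    ; apex    = λ j → j ↑ˡ w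
    ; size    = λ j → trans (∣p++q∣ (∁ ⁅ j ⁆) _) (cong₂ _+_ (∣∁⁅⁆∣ j) (∣interval∣ (start j) s w (fits j)))
    ; apex∉   = core∉
    ; apex∈   = λ i≢j → core∈ (λ j≡i → i≢j (sym j≡i))
    ; covered = covered
    ; avoided = avoided
    }
    where
    covered : ∀ v → ∃[ j ] v ∈ member j
    covered v with side {suc m} v
    ... | core a with another 1≤m a
    ...   | j , j≢a = j , core∈ (λ a≡j → j≢a (sym a≡j))
    covered v | window x with covers x
    ...   | j , x∈I = j , window∈ x∈I

    avoided : ∀ v j → v ≢ j ↑ˡ w → ∃[ i ] i ≢ j × v ∉ member i
    avoided v j v≢aj with side {suc m} v
    ... | core a = a , (λ a≡j → v≢aj (cong (_↑ˡ w) a≡j)) , core∉ a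
    ... | window x with missedTwice x
    ...   | j₁ , j₂ , j₁≢j₂ , x∉I₁ , x∉I₂ with j₁ ≟ᶠ j
    ...     | yes refl = j₂ , (λ j₂≡j₁ → j₁≢j₂ (sym j₂≡j₁)) , window∉ x∉I₂
    ...     | no j₁≢j  = j₁ , j₁≢j , window∉ x∉I₁

  interval-family : PrimitiveExists (suc m + w) (m + s)
  interval-family = H , primitive-saturated
    where open FamilyHypergraph family

before-interval : ∀ {c s x} → x < c → ¬ InInterval c s x
before-interval x<c (c≤x , _) = <⇒≱ x<c c≤x

after-interval : ∀ {c s x} → c + s ≤ x → ¬ InInterval c s x
after-interval c+s≤x (_ , x<c+s) = <⇒≱ x<c+s c+s≤x

-- At least three intervals of length L = suc s, placed at 0, L, 2L, ... and
-- pushed back into the window: start j = min (j L) (w - L).  With M + 1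
-- intervals, M = m + 2, they cover the window when w ≤ (M + 1) L, and the
-- first three are pairwise disjoint when 3L ≤ w.
module SpacedIntervals {m s w : ℕ} (3L≤w : 3 * suc s ≤ w) (w≤[M+1]L : w ≤ suc (suc (suc m)) * suc s) where

  M : ℕ
  M = suc (suc m)

  L : ℕ
  L = suc s

  start : Fin (suc M) → ℕ
  start j = (toℕ j * L) ⊓ (w ∸ L)

  L≤w : L ≤ w
  L≤w = ≤-trans (m≤m+n L (2 * L)) 3L≤w

  fits : ∀ j → start j + L ≤ w
  fits j = ≤-trans (+-monoˡ-≤ L (m⊓n≤n (toℕ j * L) (w ∸ L))) (≤-reflexive (m∸n+n≡m L≤w))

  unclamped : ∀ j → toℕ j ≤ 2 → start j ≡ toℕ j * L
  unclamped j j≤2 = m≤n⇒m⊓n≡m (m+n≤o⇒m≤o∸n (toℕ j * L) (begin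
    toℕ j * L + L  ≤⟨ +-monoˡ-≤ L (*-monoˡ-≤ L j≤2) ⟩
    2 * L + L      ≡⟨ two-plus-one L ⟩
    3 * L          ≤⟨ 3L≤w ⟩
    w              ∎))
    where
    open ≤-Reasoning
    two-plus-one : ∀ L → 2 * L + L ≡ 3 * L
    two-plus-one = solve-∀

  -- Below w - L the point x lies in the interval of index ⌊x / L⌋; above,
  -- it lies in the last interval, which is clamped to [w - L, w).
  covers : ∀ (x : Fin w) → ∃[ j ] InInterval (start j) L (toℕ x)
  covers x with toℕ x <? w ∸ L
  ... | yes x<w-L = index , subst (λ c → InInterval c L (toℕ x)) (sym start-index) (q*L≤x , x<q*L+L)
    where
    q : ℕ
    q = toℕ x / L
    q*L≤x : q * L ≤ toℕ x
    q*L≤x = m/n*n≤m (toℕ x) L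
    x<q*L+L : toℕ x < q * L + L
    x<q*L+L = begin-strict
      toℕ x                   ≡⟨ m≡m%n+[m/n]*n (toℕ x) L ⟩
      toℕ x % L + q * L       <⟨ +-monoˡ-< (q * L) (m%n<n (toℕ x) L) ⟩
      L + q * L               ≡⟨ +-comm L (q * L) ⟩
      q * L + L               ∎
      where open ≤-Reasoning
    q<M+1 : q < suc M
    q<M+1 = *-cancelʳ-< L q (suc M) (≤-<-trans q*L≤x (<-≤-trans (toℕ<n x) w≤[M+1]L))
    index : Fin (suc M)
    index = fromℕ< q<M+1
    start-index : start index ≡ q * L
    start-index = trans (cong (λ t → (t * L) ⊓ (w ∸ L)) (toℕ-fromℕ< q<M+1))
                        (m≤n⇒m⊓n≡m (≤-trans q*L≤x (<⇒≤ x<w-L)))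
  ... | no x≮w-L = fromℕ M , subst (λ c → InInterval c L (toℕ x)) (sym start-last) (≮⇒≥ x≮w-L , x<w)
    where
    start-last : start (fromℕ M) ≡ w ∸ L
    start-last = trans (cong (λ t → (t * L) ⊓ (w ∸ L)) (toℕ-fromℕ M))
                       (m≥n⇒m⊓n≡n (m≤n+o⇒m∸n≤o w L w≤[M+1]L))
    x<w : toℕ x < w ∸ L + L
    x<w = subst (toℕ x <_) (sym (m∸n+n≡m L≤w)) (toℕ<n x)

  j₀ j₁ j₂ : Fin (suc M)
  j₀ = zero
  j₁ = suc zero
  j₂ = suc (suc zero)

  missed-before : ∀ j → toℕ j ≤ 2 → ∀ {x} → x < toℕ j * L → ¬ InInterval (start j) L x
  missed-before j j≤2 x<jL rewrite unclamped j j≤2 = before-interval x<jL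

  missed-after : ∀ j → toℕ j ≤ 2 → ∀ {x} → toℕ j * L + L ≤ x → ¬ InInterval (start j) L x
  missed-after j j≤2 jL+L≤x rewrite unclamped j j≤2 = after-interval jL+L≤x

  missedTwice : ∀ (x : Fin w) → ∃[ i ] ∃[ j ] i ≢ j ×
                  ¬ InInterval (start i) L (toℕ x) × ¬ InInterval (start j) L (toℕ x)
  missedTwice x with toℕ x <? 1 * L | toℕ x <? 2 * L
  ... | yes x<L | _ =
    j₁ , j₂ , (λ ()) , missed-before j₁ (s≤s z≤n) x<L ,
    missed-before j₂ ≤-refl (<-≤-trans x<L (*-monoˡ-≤ L (n≤1+n 1)))
  ... | no x≮L | yes x<2L =
    j₀ , j₂ , (λ ()) , missed-after j₀ z≤n (subst (_≤ toℕ x) (*-identityˡ L) (≮⇒≥ x≮L)) ,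
    missed-before j₂ ≤-refl x<2L
  ... | no x≮L | no x≮2L =
    j₀ , j₁ , (λ ()) , missed-after j₀ z≤n (subst (_≤ toℕ x) (*-identityˡ L) (≮⇒≥ x≮L)) ,
    missed-after j₁ (s≤s z≤n) (subst (_≤ toℕ x) (one-plus-one L) (≮⇒≥ x≮2L))
    where
    one-plus-one : ∀ L → 2 * L ≡ 1 * L + L
    one-plus-one = solve-∀

  family : PrimitiveExists (suc M + w) (M + L)
  family = IntervalFamily.interval-family start (s≤s z≤n) fits covers missedTwice

spaced-intervals : ∀ {m s w} → 2 ≤ m → 3 * suc s ≤ w → w ≤ suc m * suc s →
                   PrimitiveExists (suc m + w) (m + suc s)
spaced-intervals {suc zero}    (s≤s ())
spaced-intervals {suc (suc m)} _ 3L≤w w≤[m+1]L = SpacedIntervals.family {m} 3L≤w w≤[m+1]L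

alternating-intervals : ∀ {m} → 3 ≤ m → PrimitiveExists (suc m + 2) (m + 1)
alternating-intervals {suc zero}       (s≤s ())
alternating-intervals {suc (suc zero)} (s≤s (s≤s ()))
alternating-intervals {m@(suc (suc (suc _)))} _ =
  IntervalFamily.interval-family start (s≤s z≤n) fits covers missedTwice
  where
  start : Fin (suc m) → ℕ
  start j = toℕ j % 2

  fits : ∀ j → start j + 1 ≤ 2
  fits j = subst (_≤ 2) (+-comm 1 (start j)) (m%n<n (toℕ j) 2)

  covers : ∀ (x : Fin 2) → ∃[ j ] InInterval (start j) 1 (toℕ x)
  covers zero       = zero , z≤n , s≤s z≤n
  covers (suc zero) = suc zero , s≤s z≤n , s≤s (s≤s z≤n)

  missedTwice : ∀ (x : Fin 2) → ∃[ i ] ∃[ j ] i ≢ j ×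
                  ¬ InInterval (start i) 1 (toℕ x) × ¬ InInterval (start j) 1 (toℕ x)
  missedTwice zero       =
    suc zero , suc (suc (suc zero)) , (λ ()) , before-interval (s≤s z≤n) , before-interval (s≤s z≤n)
  missedTwice (suc zero) =
    zero , suc (suc zero) , (λ ()) , after-interval (s≤s z≤n) , after-interval (s≤s z≤n)

halves : ∀ k → ∃[ h ] ∃[ e ] e ≤ 1 × h + (h + e) ≡ k
halves zero          = 0 , 0 , z≤n , refl
halves (suc zero)    = 0 , 1 , ≤-refl , refl
halves (suc (suc k)) with halves k
... | h , e , e≤1 , refl = suc h , e , e≤1 , cong suc (+-suc h (h + e))

quarter : ∀ {x y} → 4 * x ≤ 4 * y + 1 → x ≤ y
quarter {x} {y} 4x≤4y+1 = ≮⇒≥ λ y<x → contradiction (+-cancelʳ-≤ (4 * y) 4 1 (begin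
  4 + 4 * y  ≡⟨ *-suc 4 y ⟨
  4 * suc y  ≤⟨ *-monoʳ-≤ 4 y<x ⟩
  4 * x      ≤⟨ 4x≤4y+1 ⟩
  4 * y + 1  ≡⟨ +-comm (4 * y) 1 ⟩
  1 + 4 * y  ∎)) λ { (s≤s ()) }
  where open ≤-Reasoning

-- If 4n ≤ (a + b)² for b = a or b = a + 1, then n ≤ ab, since (a + b)² = 4ab + (b - a)².
product-bound : ∀ a e n → e ≤ 1 → 4 * n ≤ (a + (a + e)) * (a + (a + e)) → n ≤ a * (a + e)
product-bound a e n e≤1 bound = quarter (begin
  4 * n                          ≤⟨ bound ⟩
  (a + (a + e)) * (a + (a + e))  ≡⟨ square-split a e ⟩
  4 * (a * (a + e)) + e * e      ≤⟨ +-monoʳ-≤ (4 * (a * (a + e))) (*-mono-≤ e≤1 e≤1) ⟩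
  4 * (a * (a + e)) + 1          ∎)
  where
  open ≤-Reasoning
  square-split : ∀ a e → (a + (a + e)) * (a + (a + e)) ≡ 4 * (a * (a + e)) + e * e
  square-split = solve-∀

near-case : ∀ {k} → 4 ≤ k → PrimitiveExists (k + 2) k
near-case {suc m} (s≤s 3≤m) = subst (PrimitiveExists (suc m + 2)) (+-comm m 1) (alternating-intervals 3≤m)

middle-case : ∀ {k n} → 4 ≤ k → k + 2 < n → n ≤ k + k → PrimitiveExists n k
middle-case {suc m} {n} (s≤s 3≤m) k+2<n n≤2k =
  subst₂ PrimitiveExists (m+[n∸m]≡n k≤n) (+-comm m 1)
    (spaced-intervals {m} {0} {n ∸ suc m} (≤-trans (n≤1+n 2) 3≤m) 3≤w w≤k)
  where
  k≤n : suc m ≤ n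
  k≤n = ≤-trans (m≤m+n (suc m) 2) (<⇒≤ k+2<n)
  3≤w : 3 ≤ n ∸ suc m
  3≤w = m+n≤o⇒m≤o∸n 3 (subst (_≤ n) (cong (λ i → suc (suc i)) (+-comm m 2)) k+2<n)
  w≤k : n ∸ suc m ≤ suc m * 1
  w≤k = subst (n ∸ suc m ≤_) (sym (*-identityʳ (suc m))) (m≤n+o⇒m∸n≤o n (suc m) n≤2k)

-- n > 2k with k = h + (h + e): h + e + 1 spaced intervals of length h in a
-- window of size n - (h + e + 1).  The window fits since
-- n ≤ (h + 1)(h + 1 + e) by the hypothesis 4n ≤ (k + 2)².
far-case : ∀ {h e n} → e ≤ 1 → 4 ≤ h + (h + e) → (h + (h + e)) + (h + (h + e)) < n →
           4 * n ≤ (h + (h + e) + 2) * (h + (h + e) + 2) → PrimitiveExists n (h + (h + e))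
far-case {zero}     e≤1 4≤k              _ _ = contradiction (≤-trans 4≤k e≤1) λ { (s≤s ()) }
far-case {suc zero} e≤1 (s≤s (s≤s 2≤e)) _ _ = contradiction (≤-trans 2≤e e≤1) λ { (s≤s ()) }
far-case {h@(suc s@(suc _))} {e} {n} e≤1 _ 2k<n bound =
  subst₂ PrimitiveExists (m+[n∸m]≡n M≤n) (+-comm (h + e) h)
    (spaced-intervals {h + e} {s} {n ∸ M} (≤-trans (s≤s (s≤s z≤n)) (m≤m+n h e)) 3h≤w w≤Mh)
  where
  M : ℕ
  M = suc (h + e)

  3h+M≤n : 3 * h + M ≤ n
  3h+M≤n = ≤-trans (≤-trans (m≤m+n (3 * h + M) e) (≤-reflexive (2k+1 h e))) 2k<n
    where
    2k+1 : ∀ h e → 3 * h + suc (h + e) + e ≡ suc ((h + (h + e)) + (h + (h + e)))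
    2k+1 = solve-∀

  M≤n : M ≤ n
  M≤n = m+n≤o⇒n≤o (3 * h) 3h+M≤n

  3h≤w : 3 * h ≤ n ∸ M
  3h≤w = m+n≤o⇒m≤o∸n (3 * h) 3h+M≤n

  n≤M+Mh : n ≤ M + M * h
  n≤M+Mh = subst (n ≤_) (product h e) (product-bound (suc h) e n e≤1 (subst (λ t → 4 * n ≤ t * t) (k+2 h e) bound))
    where
    k+2 : ∀ h e → h + (h + e) + 2 ≡ suc h + (suc h + e)
    k+2 = solve-∀
    product : ∀ h e → suc h * (suc h + e) ≡ suc (h + e) + suc (h + e) * h
    product = solve-∀

  w≤Mh : n ∸ M ≤ M * h
  w≤Mh = m≤n+o⇒m∸n≤o n M n≤M+Mh

sufficient : ∀ {k n} → 4 ≤ k → k + 2 ≤ n → 4 * n ≤ (k + 2) * (k + 2) → PrimitiveExists n k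
sufficient {k} {n} 4≤k k+2≤n bound with n ≤? k + k
... | yes n≤2k with m≤n⇒m<n∨m≡n k+2≤n
...   | inj₁ k+2<n = middle-case 4≤k k+2<n n≤2k
...   | inj₂ refl  = near-case 4≤k
sufficient {k} {n} 4≤k k+2≤n bound | no n≰2k with halves k
... | h , e , e≤1 , refl = far-case {h} e≤1 4≤k (≰⇒> n≰2k) bound

theorem8 : (k n : ℕ) → 4 ≤ k →
    ((k < n ∸ 1) × Σ (Hypergraph n) (λ H → PrimitiveUniquelySaturated k (n ∸ 1) H))
    ⇔ ((k + 2 ≤ n) × (4 * n ≤ (k + 2) * (k + 2)))
theorem8 k n 4≤k = mk⇔
  (λ (k<n-1 , H-primitive) → necessary k<n-1 H-primitive)
  (λ (k+2≤n , bound) → k<n-1 k+2≤n , sufficient 4≤k k+2≤n bound)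
  where
  k<n-1 : k + 2 ≤ n → k < n ∸ 1
  k<n-1 k+2≤n = subst (_≤ n ∸ 1) (cong (_∸ 1) (+-comm k 2)) (∸-monoˡ-≤ 1 k+2≤n)
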